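{- Let $K$ be a real closed $H$-field. If $X\subseteq K^n$ is quantifier-free definable, then its trace $X\cap C^n$ in the field $C$ of constants is semialgebraic.
   Context: An $H$-field is an ordered differential field $K$ with constant field $C=\{a\in K: a'=0\}$, $\mathcal{O}=\{a\in K: |a|\le c \text{ for some } c\in C^{>0}\}$ (the convex hull of $C$) and $\mathfrak{o}=\{a\in K: |a|<c \text{ for all } c\in C^{>0}\}$ (the maximal ideal of $\mathcal{O}$), such that (H1) $\mathcal{O}=C+\mathfrak{o}$ and (H2) $a>C \Rightarrow a'>0$. $K$ is viewed as a structure in the language $\mathcal L=\{0,1,+,-,\cdot,\partial,\le,\preceq\}$ of ordered valued differential rings, where $\partial$ names the derivation and $f\preceq g$ iff $|f|\le c|g|$ for some $c\in C^{>0}$. "Quantifier-free definable" means definable in $K$ by a quantifier-free $\mathcal L$-formula with names for elements of $K$ as parameters. "Semialgebraic" is in the sense of the real closed field $C$. -}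

module Defs where

open import Level using (0ℓ)
open import Data.Nat using (ℕ; suc) renaming (_+_ to _+ℕ_)
open import Data.Fin using (Fin)
open import Data.List using (List; []; _∷_; _++_; [_]; length)
open import Data.Product using (Σ; ∃; ∃-syntax; _×_; _,_; proj₁)
open import Data.Sum using (_⊎_)
open import Data.Unit using (⊤)
open import Data.Empty using (⊥)
open import Relation.Nullary using (¬_)
open import Relation.Binary.PropositionalEquality using (_≡_; _≢_)
open import Algebra.Structures using (IsCommutativeRing)
open import Relation.Binary.Structures using (IsTotalOrder)

record HField : Set₁ where
  infixl 6 _+_
  infixl 7 _*_
  infix 4 _≤_
  field
    Carrier : Set
    _+_ _*_ : Carrier → Carrier → Carrier
    -_      : Carrier → Carrier
    0# 1#   : Carrier
    ∂       : Carrier → Carrier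
    _≤_     : Carrier → Carrier → Set
    isCommutativeRing : IsCommutativeRing _≡_ _+_ _*_ -_ 0# 1#
    0≢1     : 0# ≢ 1#
    inverse : ∀ a → a ≢ 0# → ∃[ b ] (a * b ≡ 1#)
    isTotalOrder : IsTotalOrder _≡_ _≤_
    +-mono-≤ : ∀ a b c → a ≤ b → a + c ≤ b + c
    *-nonneg : ∀ a b → 0# ≤ a → 0# ≤ b → 0# ≤ a * b
    ∂-+ : ∀ a b → ∂ (a + b) ≡ ∂ a + ∂ b
    ∂-* : ∀ a b → ∂ (a * b) ≡ ∂ a * b + a * ∂ b

  _<_ : Carrier → Carrier → Set
  a < b = (a ≤ b) × (a ≢ b)

  _-_ : Carrier → Carrier → Carrier
  a - b = a + (- b)

  IsConst : Carrier → Set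
  IsConst a = ∂ a ≡ 0#

  IsAbs : Carrier → Carrier → Set
  IsAbs v a = ((v ≡ a) ⊎ (v ≡ - a)) × (0# ≤ v)

  AbsLe : Carrier → Carrier → Set
  AbsLe a b = ∃[ v ] (IsAbs v a × v ≤ b)

  AbsLt : Carrier → Carrier → Set
  AbsLt a b = ∃[ v ] (IsAbs v a × v < b)

  -- 𝒪 : convex hull of C
  InO : Carrier → Set
  InO a = ∃[ c ] (IsConst c × 0# < c × AbsLe a c)

  -- 𝔬 : maximal ideal of 𝒪
  Ino : Carrier → Set
  Ino a = ∀ c → IsConst c → 0# < c → AbsLt a c

  _≼_ : Carrier → Carrier → Set
  f ≼ g = ∃[ c ] (IsConst c × 0# < c ×
            ∃[ u ] ∃[ v ] (IsAbs u f × IsAbs v g × u ≤ c * v))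

  field
    -- (H1)  𝒪 = C + 𝔬
    H1  : ∀ a → InO a → ∃[ c ] (IsConst c × Ino (a - c))
    H1' : ∀ c e → IsConst c → Ino e → InO (c + e)
    H2  : ∀ a → (∀ c → IsConst c → c < a) → 0# < ∂ a

module _ (K : HField) where
  open HField K

  -- Horner evaluation; coefficient list a₀ ∷ a₁ ∷ … (lowest degree first)
  evalPoly : List Carrier → Carrier → Carrier
  evalPoly []       x = 0#
  evalPoly (a ∷ as) x = a + x * evalPoly as x

  -- every nonnegative element is a square, and every monic polynomial
  -- of odd degree 2k+1 has a root
  RealClosed : Set
  RealClosed =
    (∀ a → 0# ≤ a → ∃[ b ] (b * b ≡ a)) ×
    (∀ (k : ℕ) (as : List Carrier) → length as ≡ suc (k +ℕ k) →
       ∃[ x ] (evalPoly (as ++ [ 1# ]) x ≡ 0#))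

module _ (K : HField) where
  open HField K

  data Term (n : ℕ) : Set where
    var : Fin n → Term n
    par : Carrier → Term n
    `0 `1 : Term n
    _`+_ _`*_ : Term n → Term n → Term n
    `-_ `∂ : Term n → Term n

  data QF (n : ℕ) : Set where
    _`≡_ _`≤_ _`≼_ : Term n → Term n → QF n
    `⊤ `⊥ : QF n
    `¬_ : QF n → QF n
    _`∧_ _`∨_ : QF n → QF n → QF n

  evalT : ∀ {n} → (Fin n → Carrier) → Term n → Carrier
  evalT x (var i)   = x i
  evalT x (par a)   = a
  evalT x `0        = 0#
  evalT x `1        = 1#
  evalT x (s `+ t)  = evalT x s + evalT x t
  evalT x (s `* t)  = evalT x s * evalT x t
  evalT x (`- t)    = - evalT x t
  evalT x (`∂ t)    = ∂ (evalT x t)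

  Sat : ∀ {n} → (Fin n → Carrier) → QF n → Set
  Sat x (s `≡ t) = evalT x s ≡ evalT x t
  Sat x (s `≤ t) = evalT x s ≤ evalT x t
  Sat x (s `≼ t) = evalT x s ≼ evalT x t
  Sat x `⊤       = ⊤
  Sat x `⊥       = ⊥
  Sat x (`¬ φ)   = ¬ Sat x φ
  Sat x (φ `∧ ψ) = Sat x φ × Sat x ψ
  Sat x (φ `∨ ψ) = Sat x φ ⊎ Sat x ψ

  QFDefinable : ∀ n → ((Fin n → Carrier) → Set) → Set
  QFDefinable n X = ∃[ φ ] (∀ x → (X x → Sat x φ) × (Sat x φ → X x))

  Const : Set
  Const = Σ Carrier IsConst

  data CTerm (n : ℕ) : Set where
    var : Fin n → CTerm n
    par : Const → CTerm n
    `0 `1 : CTerm n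
    _`+_ _`*_ : CTerm n → CTerm n → CTerm n
    `-_ : CTerm n → CTerm n

  data CQF (n : ℕ) : Set where
    _`≡_ _`≤_ : CTerm n → CTerm n → CQF n
    `⊤ `⊥ : CQF n
    `¬_ : CQF n → CQF n
    _`∧_ _`∨_ : CQF n → CQF n → CQF n

  -- evaluation at points of C^n (computed inside K; C is a subfield and
  -- its ordering is the restriction of that of K)
  evalCT : ∀ {n} → (Fin n → Const) → CTerm n → Carrier
  evalCT x (var i)  = proj₁ (x i)
  evalCT x (par c)  = proj₁ c
  evalCT x `0       = 0#
  evalCT x `1       = 1#
  evalCT x (s `+ t) = evalCT x s + evalCT x t
  evalCT x (s `* t) = evalCT x s * evalCT x t
  evalCT x (`- t)   = - evalCT x t

  SatC : ∀ {n} → (Fin n → Const) → CQF n → Set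
  SatC x (s `≡ t) = evalCT x s ≡ evalCT x t
  SatC x (s `≤ t) = evalCT x s ≤ evalCT x t
  SatC x `⊤       = ⊤
  SatC x `⊥       = ⊥
  SatC x (`¬ φ)   = ¬ SatC x φ
  SatC x (φ `∧ ψ) = SatC x φ × SatC x ψ
  SatC x (φ `∨ ψ) = SatC x φ ⊎ SatC x ψ

  Semialgebraic : ∀ n → ((Fin n → Const) → Set) → Set
  Semialgebraic n Y = ∃[ φ ] (∀ x → (Y x → SatC x φ) × (SatC x φ → Y x))

  trace : ∀ {n} → ((Fin n → Carrier) → Set) → (Fin n → Const) → Set
  trace X x = X (λ i → proj₁ (x i))

module Submission where

-- Let x range over Cⁿ.  Since the derivation kills constants, every term
-- t(x) of K expands as a finite sum Σⱼ bⱼ·Qⱼ(x) with coefficients bⱼ ∈ K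
-- not depending on x and polynomials Qⱼ with coefficients in C.  Using
-- axiom (H1) (every element of 𝒪 is a constant plus an infinitesimal) the
-- expansion can be normalised so that each coefficient is infinitesimal
-- with respect to the previous one.  At a given x the value of a normal
-- expansion is then governed by its first summand with Qⱼ(x) ≠ 0, so the
-- atomic conditions t = 0, t ≥ 0 and s ≼ t become Boolean combinations of
-- polynomial (in)equalities over C, whose only non-semialgebraic
-- ingredients are fixed truth values of statements about the bⱼ.
--
-- Proposition 5.1 follows at once.

open import Level using (0ℓ)
open import Algebra.Bundles using (CommutativeRing)
open import Data.Nat as ℕ using (ℕ; zero; suc)
open import Data.Nat.Properties using (+-suc)
open import Data.Integer as ℤ using (ℤ; -[1+_]; ∣_∣; sign)
open import Data.Integer.Properties using ([1+m]⊖[1+n]≡m⊖n)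
open import Data.Sign as Sign using (Sign)
open import Data.Maybe using (Maybe; just; nothing)
open import Relation.Nullary using (¬_; yes; no)
import Relation.Binary.PropositionalEquality as ≡

-- The ring solver of the library, instantiated for an arbitrary
-- commutative ring with integer coefficients.  The only work is the
-- canonical ring morphism ℤ → R, n ↦ n·1.
module IntegerCoefficientSolver (R : CommutativeRing 0ℓ 0ℓ) where
  open CommutativeRing R
  open import Algebra.Properties.Ring ring using (-1*x≈-x; -‿involutive; -0#≈0#)
  open import Algebra.Properties.AbelianGroup +-abelianGroup using (⁻¹-∙-comm)
  open import Algebra.Properties.Semiring.Mult.TCOptimised semiring using (_×_; 1+×; ×-homo-+; ×1-homo-*)
  open import Relation.Binary.Reasoning.Setoid setoid
  import Algebra.Solver.Ring.AlmostCommutativeRing as ACR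

  ⟦_⟧ℤ : ℤ → Carrier
  ⟦ ℤ.+ n ⟧ℤ    = n × 1#
  ⟦ -[1+ n ] ⟧ℤ = - (suc n × 1#)

  private
    sgn : Sign → Carrier
    sgn Sign.+ = 1#
    sgn Sign.- = - 1#

    sgn-* : ∀ s t → sgn (s Sign.* t) ≈ sgn s * sgn t
    sgn-* Sign.+ Sign.+ = sym (*-identityˡ _)
    sgn-* Sign.+ Sign.- = sym (*-identityˡ _)
    sgn-* Sign.- Sign.+ = sym (*-identityʳ _)
    sgn-* Sign.- Sign.- = sym (trans (-1*x≈-x _) (-‿involutive _))

    ⟦⟧-sign : ∀ i → ⟦ i ⟧ℤ ≈ sgn (sign i) * (∣ i ∣ × 1#)
    ⟦⟧-sign (ℤ.+ n)   = sym (*-identityˡ _)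
    ⟦⟧-sign -[1+ n ] = sym (-1*x≈-x _)

    ⟦⟧-◃ : ∀ s n → ⟦ s ℤ.◃ n ⟧ℤ ≈ sgn s * (n × 1#)
    ⟦⟧-◃ s zero          = sym (zeroʳ _)
    ⟦⟧-◃ Sign.+ (suc n) = sym (*-identityˡ _)
    ⟦⟧-◃ Sign.- (suc n) = sym (-1*x≈-x _)

    interchange : ∀ a b c d → (a * b) * (c * d) ≈ (a * c) * (b * d)
    interchange a b c d = begin
      (a * b) * (c * d) ≈⟨ *-assoc a b (c * d) ⟩
      a * (b * (c * d)) ≈⟨ *-congˡ (sym (*-assoc b c d)) ⟩
      a * ((b * c) * d) ≈⟨ *-congˡ (*-congʳ (*-comm b c)) ⟩
      a * ((c * b) * d) ≈⟨ *-congˡ (*-assoc c b d) ⟩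
      a * (c * (b * d)) ≈⟨ sym (*-assoc a c (b * d)) ⟩
      (a * c) * (b * d) ∎

    *-homo : ∀ i j → ⟦ i ℤ.* j ⟧ℤ ≈ ⟦ i ⟧ℤ * ⟦ j ⟧ℤ
    *-homo i j = begin
      ⟦ i ℤ.* j ⟧ℤ
        ≈⟨ ⟦⟧-◃ (sign i Sign.* sign j) (∣ i ∣ ℕ.* ∣ j ∣) ⟩
      sgn (sign i Sign.* sign j) * ((∣ i ∣ ℕ.* ∣ j ∣) × 1#)
        ≈⟨ *-cong (sgn-* (sign i) (sign j)) (×1-homo-* ∣ i ∣ ∣ j ∣) ⟩
      (sgn (sign i) * sgn (sign j)) * ((∣ i ∣ × 1#) * (∣ j ∣ × 1#))
        ≈⟨ interchange _ _ _ _ ⟩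
      (sgn (sign i) * (∣ i ∣ × 1#)) * (sgn (sign j) * (∣ j ∣ × 1#))
        ≈⟨ sym (*-cong (⟦⟧-sign i) (⟦⟧-sign j)) ⟩
      ⟦ i ⟧ℤ * ⟦ j ⟧ℤ ∎

    -‿homo : ∀ i → ⟦ ℤ.- i ⟧ℤ ≈ - ⟦ i ⟧ℤ
    -‿homo (ℤ.+ zero)  = sym -0#≈0#
    -‿homo (ℤ.+ suc n) = refl
    -‿homo -[1+ n ]    = sym (-‿involutive _)

    cancel-1 : ∀ a b → (1# + a) - (1# + b) ≈ a - b
    cancel-1 a b = begin
      (1# + a) + - (1# + b)   ≈⟨ +-congˡ (sym (⁻¹-∙-comm 1# b)) ⟩
      (1# + a) + (- 1# + - b) ≈⟨ +-congʳ (+-comm 1# a) ⟩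
      (a + 1#) + (- 1# + - b) ≈⟨ +-assoc a 1# _ ⟩
      a + (1# + (- 1# + - b)) ≈⟨ +-congˡ (sym (+-assoc 1# (- 1#) (- b))) ⟩
      a + ((1# + - 1#) + - b) ≈⟨ +-congˡ (+-congʳ (-‿inverseʳ 1#)) ⟩
      a + (0# + - b)          ≈⟨ +-congˡ (+-identityˡ (- b)) ⟩
      a + - b ∎

    ⊖-homo : ∀ m n → ⟦ m ℤ.⊖ n ⟧ℤ ≈ (m × 1#) - (n × 1#)
    ⊖-homo m zero = sym (trans (+-congˡ -0#≈0#) (+-identityʳ _))
    ⊖-homo zero (suc n) = sym (+-identityˡ _)
    ⊖-homo (suc m) (suc n) = begin
      ⟦ suc m ℤ.⊖ suc n ⟧ℤ       ≡⟨ ≡.cong ⟦_⟧ℤ ([1+m]⊖[1+n]≡m⊖n m n) ⟩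
      ⟦ m ℤ.⊖ n ⟧ℤ               ≈⟨ ⊖-homo m n ⟩
      (m × 1#) - (n × 1#)                 ≈⟨ cancel-1 _ _ ⟨
      (1# + m × 1#) - (1# + n × 1#)       ≈⟨ +-cong (1+× m 1#) (-‿cong (1+× n 1#)) ⟨
      (suc m × 1#) - (suc n × 1#) ∎

    +-homo : ∀ i j → ⟦ i ℤ.+ j ⟧ℤ ≈ ⟦ i ⟧ℤ + ⟦ j ⟧ℤ
    +-homo (ℤ.+ m)     (ℤ.+ n)     = ×-homo-+ 1# m n
    +-homo (ℤ.+ m)     -[1+ n ] = ⊖-homo m (suc n)
    +-homo -[1+ m ] (ℤ.+ n)     = trans (⊖-homo n (suc m)) (+-comm _ _)
    +-homo -[1+ m ] -[1+ n ] = begin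
      - (suc (suc (m ℕ.+ n)) × 1#)         ≡⟨ ≡.cong (λ k → - (k × 1#)) (+-suc (suc m) n) ⟨
      - ((suc m ℕ.+ suc n) × 1#)            ≈⟨ -‿cong (×-homo-+ 1# (suc m) (suc n)) ⟩
      - ((suc m × 1#) + (suc n × 1#))       ≈⟨ ⁻¹-∙-comm _ _ ⟨
      - (suc m × 1#) + - (suc n × 1#) ∎

    almostCommutativeRing : ACR.AlmostCommutativeRing 0ℓ 0ℓ
    almostCommutativeRing = ACR.fromCommutativeRing R

    ℤ⟶R : ℤ.+-*-rawRing ACR.-Raw-AlmostCommutative⟶ almostCommutativeRing
    ℤ⟶R = record
      { ⟦_⟧ = ⟦_⟧ℤ ; +-homo = +-homo ; *-homo = *-homo ; -‿homo = -‿homo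
      ; 0-homo = refl ; 1-homo = refl }

    -- coefficient equality is only ever detected syntactically
    coefficient≟ : ∀ i j → Maybe (⟦ i ⟧ℤ ≈ ⟦ j ⟧ℤ)
    coefficient≟ i j with i ℤ.≟ j
    ... | yes ≡.refl = just refl
    ... | no _       = nothing

  open import Algebra.Solver.Ring ℤ.+-*-rawRing almostCommutativeRing ℤ⟶R coefficient≟ public

open import Data.Fin using (Fin)
open import Data.List using (List; []; _∷_; _++_)
open import Data.List.Relation.Unary.All as All using (All; []; _∷_)
open import Data.Product using (∃-syntax; _×_; _,_; proj₁; proj₂)
open import Data.Sum using (_⊎_; inj₁; inj₂; [_,_]′)
open import Data.Unit using (⊤; tt)
open import Data.Empty using (⊥; ⊥-elim)
open import Function using (id; _∘_)
open import Function.Bundles using (_⇔_; mk⇔; Equivalence)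
import Function.Properties.Equivalence as ⇔
open import Function.Related.TypeIsomorphisms using (¬-cong-⇔)
open import Data.Product.Function.NonDependent.Propositional using (_×-⇔_)
open import Data.Sum.Function.Propositional using (_⊎-⇔_)
open import Relation.Binary.PropositionalEquality
open import Relation.Binary.Structures using (IsTotalOrder)
open import Axiom.ExcludedMiddle using (ExcludedMiddle)
open import Defs

module FieldFacts (K : HField) where
  open HField K

  commutativeRing : CommutativeRing 0ℓ 0ℓ
  commutativeRing = record { isCommutativeRing = isCommutativeRing }

  open CommutativeRing commutativeRing public
    using ( +-identityˡ; +-identityʳ; *-identityˡ; *-identityʳ; zeroˡ; zeroʳ
          ; +-comm; *-comm; +-assoc; *-assoc; -‿inverseʳ; distribʳ)
  open import Algebra.Properties.Ring (CommutativeRing.ring commutativeRing) public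
    using (-‿involutive; -0#≈0#; -‿distribˡ-*; -‿distribʳ-*; -‿+-comm;
           +-inverseʳ-unique; x∙y⁻¹≈ε⇒x≈y; x+x≈x⇒x≈0)
  open IntegerCoefficientSolver commutativeRing public
    using (solve; _:+_; _:*_; :-_; _:=_)
  open IsTotalOrder isTotalOrder public
    using (total; antisym) renaming (refl to ≤-refl; trans to ≤-trans; reflexive to ≤-reflexive)

  cancel-nonzero : ∀ {a b} → a ≢ 0# → a * b ≡ 0# → b ≡ 0#
  cancel-nonzero {a} {b} a≢0 ab≡0 = begin
    b               ≡⟨ *-identityˡ b ⟨
    1# * b          ≡⟨ cong (_* b) a⁻¹a≡1 ⟨
    (a⁻¹ * a) * b   ≡⟨ *-assoc a⁻¹ a b ⟩
    a⁻¹ * (a * b)   ≡⟨ cong (a⁻¹ *_) ab≡0 ⟩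
    a⁻¹ * 0#        ≡⟨ zeroʳ a⁻¹ ⟩
    0# ∎
    where
    open ≡-Reasoning
    a⁻¹ : Carrier
    a⁻¹ = proj₁ (inverse a a≢0)
    a⁻¹a≡1 : a⁻¹ * a ≡ 1#
    a⁻¹a≡1 = trans (*-comm a⁻¹ a) (proj₂ (inverse a a≢0))

  *-≢0 : ∀ {a b} → a ≢ 0# → b ≢ 0# → a * b ≢ 0#
  *-≢0 a≢0 b≢0 ab≡0 = b≢0 (cancel-nonzero a≢0 ab≡0)

  +-monoˡ-≤ : ∀ {a b} c → a ≤ b → c + a ≤ c + b
  +-monoˡ-≤ {a} {b} c a≤b = subst₂ _≤_ (+-comm a c) (+-comm b c) (+-mono-≤ a b c a≤b)

  +-mono₂-≤ : ∀ {a b c d} → a ≤ b → c ≤ d → a + c ≤ b + d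
  +-mono₂-≤ {a} {b} {c} a≤b c≤d = ≤-trans (+-mono-≤ a b c a≤b) (+-monoˡ-≤ b c≤d)

  +-cancelʳ-≤ : ∀ {a b} c → a + c ≤ b + c → a ≤ b
  +-cancelʳ-≤ {a} {b} c p = subst₂ _≤_ (cancel a) (cancel b) (+-mono-≤ _ _ (- c) p)
    where
    cancel : ∀ x → (x + c) + (- c) ≡ x
    cancel x = solve 2 (λ x c → (x :+ c) :+ (:- c) := x) refl x c

  neg-antitone : ∀ {a b} → a ≤ b → - b ≤ - a
  neg-antitone {a} {b} a≤b = subst₂ _≤_ (leaves-b a b) (leaves-a a b) (+-mono-≤ a b ((- a) + (- b)) a≤b)
    where
    leaves-b : ∀ a b → a + ((- a) + (- b)) ≡ - b
    leaves-a : ∀ a b → b + ((- a) + (- b)) ≡ - a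
    leaves-b = solve 2 (λ a b → a :+ ((:- a) :+ (:- b)) := :- b) refl
    leaves-a = solve 2 (λ a b → b :+ ((:- a) :+ (:- b)) := :- a) refl

  neg-antitone⁻¹ : ∀ {a b} → - a ≤ - b → b ≤ a
  neg-antitone⁻¹ {a} {b} p = subst₂ _≤_ (-‿involutive b) (-‿involutive a) (neg-antitone p)

  nonneg⇒neg≤0 : ∀ {a} → 0# ≤ a → - a ≤ 0#
  nonneg⇒neg≤0 p = subst (_ ≤_) -0#≈0# (neg-antitone p)

  nonpos⇒0≤neg : ∀ {a} → a ≤ 0# → 0# ≤ - a
  nonpos⇒0≤neg p = subst (_≤ _) -0#≈0# (neg-antitone p)

  ≤⇒0≤- : ∀ {a b} → a ≤ b → 0# ≤ b - a
  ≤⇒0≤- {a} {b} a≤b = subst (_≤ b - a) (-‿inverseʳ a) (+-mono-≤ a b (- a) a≤b)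

  0≤-⇒≤ : ∀ {a b} → 0# ≤ b - a → a ≤ b
  0≤-⇒≤ {a} {b} p = subst₂ _≤_ (+-identityˡ a) (back a b) (+-mono-≤ _ _ a p)
    where
    back : ∀ a b → (b - a) + a ≡ b
    back = solve 2 (λ a b → (b :+ (:- a)) :+ a := b) refl

  0≤both⇒≡0 : ∀ {a} → 0# ≤ a → 0# ≤ - a → a ≡ 0#
  0≤both⇒≡0 {a} p q = antisym (subst (_≤ 0#) (-‿involutive a) (nonneg⇒neg≤0 q)) p

  neg≡0⇒≡0 : ∀ {a} → - a ≡ 0# → a ≡ 0#
  neg≡0⇒≡0 {a} -a≡0 = trans (sym (-‿involutive a)) (trans (cong -_ -a≡0) -0#≈0#)

  *-monoˡ-≤ : ∀ {a b} c → 0# ≤ c → a ≤ b → c * a ≤ c * b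
  *-monoˡ-≤ {a} {b} c 0≤c a≤b =
    0≤-⇒≤ (subst (0# ≤_) (distrib-sub c b a) (*-nonneg c _ 0≤c (≤⇒0≤- a≤b)))
    where
    distrib-sub : ∀ c b a → c * (b - a) ≡ (c * b) - (c * a)
    distrib-sub = solve 3 (λ c b a → c :* (b :+ (:- a)) := c :* b :+ (:- (c :* a))) refl

  *-monoʳ-≤ : ∀ {a b} c → 0# ≤ c → a ≤ b → a * c ≤ b * c
  *-monoʳ-≤ {a} {b} c 0≤c a≤b = subst₂ _≤_ (*-comm c a) (*-comm c b) (*-monoˡ-≤ c 0≤c a≤b)

  neg*neg : ∀ a b → (- a) * (- b) ≡ a * b
  neg*neg = solve 2 (λ a b → (:- a) :* (:- b) := a :* b) refl

  nonpos*nonpos : ∀ {a b} → a ≤ 0# → b ≤ 0# → 0# ≤ a * b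
  nonpos*nonpos {a} {b} a≤0 b≤0 =
    subst (0# ≤_) (neg*neg a b) (*-nonneg _ _ (nonpos⇒0≤neg a≤0) (nonpos⇒0≤neg b≤0))

  square-nonneg : ∀ a → 0# ≤ a * a
  square-nonneg a with total 0# a
  ... | inj₁ 0≤a = *-nonneg a a 0≤a 0≤a
  ... | inj₂ a≤0 = nonpos*nonpos a≤0 a≤0

  0≤1 : 0# ≤ 1#
  0≤1 = subst (0# ≤_) (*-identityʳ 1#) (square-nonneg 1#)

  0<1 : 0# < 1#
  0<1 = 0≤1 , 0≢1

  pos⇒≢0 : ∀ {a} → 0# < a → a ≢ 0#
  pos⇒≢0 (_ , 0≢a) a≡0 = 0≢a (sym a≡0)

  *-pos : ∀ {a b} → 0# < a → 0# < b → 0# < (a * b)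
  *-pos {a} {b} 0<a 0<b =
    *-nonneg a b (proj₁ 0<a) (proj₁ 0<b) , λ 0≡ab → *-≢0 (pos⇒≢0 0<a) (pos⇒≢0 0<b) (sym 0≡ab)

  nonneg-*⁻¹ : ∀ {a b} → 0# ≤ a → a ≢ 0# → 0# ≤ a * b → 0# ≤ b
  nonneg-*⁻¹ {a} {b} 0≤a a≢0 0≤ab = [ id , b≤0⇒0≤b ]′ (total 0# b)
    where
    b≤0⇒0≤b : b ≤ 0# → 0# ≤ b
    b≤0⇒0≤b b≤0 = ≤-reflexive (sym (cancel-nonzero a≢0 ab≡0))
      where
      ab≡0 : a * b ≡ 0#
      ab≡0 = antisym (subst (a * b ≤_) (zeroʳ a) (*-monoˡ-≤ a 0≤a b≤0)) 0≤ab

  nonpos-*⁻¹ : ∀ {a b} → a ≤ 0# → a ≢ 0# → 0# ≤ a * b → b ≤ 0#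
  nonpos-*⁻¹ {a} {b} a≤0 a≢0 0≤ab = subst (_≤ 0#) (-‿involutive b) (nonneg⇒neg≤0 0≤-b)
    where
    0≤-b : 0# ≤ - b
    0≤-b = nonneg-*⁻¹ (nonpos⇒0≤neg a≤0) (a≢0 ∘ neg≡0⇒≡0)
                      (subst (0# ≤_) (sym (neg*neg a b)) 0≤ab)

  inverse-pos : ∀ {a b} → 0# < a → a * b ≡ 1# → 0# < b
  inverse-pos {a} {b} (0≤a , _) ab≡1 with total 0# b
  ... | inj₁ 0≤b = 0≤b , λ 0≡b → 0≢1 (trans (sym (zeroʳ a)) (trans (cong (a *_) 0≡b) ab≡1))
  ... | inj₂ b≤0 = ⊥-elim (0≢1 (antisym 0≤1 (subst₂ _≤_ ab≡1 (zeroʳ a) (*-monoˡ-≤ a 0≤a b≤0))))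

  abs : Carrier → Carrier
  abs a with total 0# a
  ... | inj₁ _ = a
  ... | inj₂ _ = - a

  abs-IsAbs : ∀ a → IsAbs (abs a) a
  abs-IsAbs a with total 0# a
  ... | inj₁ 0≤a = inj₁ refl , 0≤a
  ... | inj₂ a≤0 = inj₂ refl , nonpos⇒0≤neg a≤0

  abs-nonneg : ∀ a → 0# ≤ abs a
  abs-nonneg a = proj₂ (abs-IsAbs a)

  abs-cases : ∀ a → abs a ≡ a ⊎ abs a ≡ - a
  abs-cases a = proj₁ (abs-IsAbs a)

  IsAbs⇒≡abs : ∀ {v a} → IsAbs v a → v ≡ abs a
  IsAbs⇒≡abs {v} {a} (v≡±a , 0≤v) with abs-cases a | v≡±a
  ... | inj₁ e | inj₁ f = trans f (sym e)
  ... | inj₂ e | inj₂ f = trans f (sym e)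
  ... | inj₁ e | inj₂ f = trans f (trans (cong -_ a≡0) (trans -0#≈0# (sym (trans e a≡0))))
    where
    a≡0 : a ≡ 0#
    a≡0 = 0≤both⇒≡0 (subst (0# ≤_) e (abs-nonneg a)) (subst (0# ≤_) f 0≤v)
  ... | inj₂ e | inj₁ f = trans f (trans a≡0 (sym (trans e (trans (cong -_ a≡0) -0#≈0#))))
    where
    a≡0 : a ≡ 0#
    a≡0 = 0≤both⇒≡0 (subst (0# ≤_) f 0≤v) (subst (0# ≤_) e (abs-nonneg a))

  abs-of-nonneg : ∀ {a} → 0# ≤ a → abs a ≡ a
  abs-of-nonneg 0≤a = sym (IsAbs⇒≡abs (inj₁ refl , 0≤a))

  abs-neg : ∀ a → abs (- a) ≡ abs a
  abs-neg a with abs-cases a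
  ... | inj₁ e = sym (IsAbs⇒≡abs (inj₂ (trans e (sym (-‿involutive a))) , abs-nonneg a))
  ... | inj₂ e = sym (IsAbs⇒≡abs (inj₁ e , abs-nonneg a))

  abs-* : ∀ a b → abs (a * b) ≡ abs a * abs b
  abs-* a b = sym (IsAbs⇒≡abs (signs (abs-cases a) (abs-cases b) ,
                               *-nonneg _ _ (abs-nonneg a) (abs-nonneg b)))
    where
    signs : abs a ≡ a ⊎ abs a ≡ - a → abs b ≡ b ⊎ abs b ≡ - b →
            abs a * abs b ≡ a * b ⊎ abs a * abs b ≡ - (a * b)
    signs (inj₁ e) (inj₁ f) = inj₁ (cong₂ _*_ e f)
    signs (inj₁ e) (inj₂ f) = inj₂ (trans (cong₂ _*_ e f) (sym (-‿distribʳ-* a b)))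
    signs (inj₂ e) (inj₁ f) = inj₂ (trans (cong₂ _*_ e f) (sym (-‿distribˡ-* a b)))
    signs (inj₂ e) (inj₂ f) = inj₁ (trans (cong₂ _*_ e f) (neg*neg a b))

  abs≡0⇒≡0 : ∀ {a} → abs a ≡ 0# → a ≡ 0#
  abs≡0⇒≡0 {a} e with abs-cases a
  ... | inj₁ f = trans (sym f) e
  ... | inj₂ f = neg≡0⇒≡0 (trans (sym f) e)

  abs-0 : abs 0# ≡ 0#
  abs-0 = abs-of-nonneg ≤-refl

  abs-pos : ∀ {a} → a ≢ 0# → 0# < abs a
  abs-pos {a} a≢0 = abs-nonneg a , λ 0≡|a| → a≢0 (abs≡0⇒≡0 (sym 0≡|a|))

  ≤abs : ∀ a → a ≤ abs a
  ≤abs a with abs-cases a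
  ... | inj₁ e = ≤-reflexive (sym e)
  ... | inj₂ e = ≤-trans a≤0 (abs-nonneg a)
    where
    a≤0 : a ≤ 0#
    a≤0 = subst (_≤ 0#) (-‿involutive a) (nonneg⇒neg≤0 (subst (0# ≤_) e (abs-nonneg a)))

  -abs≤ : ∀ a → - abs a ≤ a
  -abs≤ a = subst₂ (λ x y → - x ≤ y) (abs-neg a) (-‿involutive a) (neg-antitone (≤abs (- a)))

  triangle : ∀ a b → abs (a + b) ≤ abs a + abs b
  triangle a b with abs-cases (a + b)
  ... | inj₁ e = subst (_≤ abs a + abs b) (sym e) (+-mono₂-≤ (≤abs a) (≤abs b))
  ... | inj₂ e = subst (_≤ abs a + abs b) (sym (trans e (sym (-‿+-comm a b))))
                       (+-mono₂-≤ (neg≤abs a) (neg≤abs b))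
    where
    neg≤abs : ∀ x → - x ≤ abs x
    neg≤abs x = subst (- x ≤_) (abs-neg x) (≤abs (- x))

  const-0 : IsConst 0#
  const-0 = x+x≈x⇒x≈0 (∂ 0#) (trans (sym (∂-+ 0# 0#)) (cong ∂ (+-identityʳ 0#)))

  const-1 : IsConst 1#
  const-1 = x+x≈x⇒x≈0 (∂ 1#) (begin
    ∂ 1# + ∂ 1#             ≡⟨ cong₂ _+_ (*-identityʳ (∂ 1#)) (*-identityˡ (∂ 1#)) ⟨
    ∂ 1# * 1# + 1# * ∂ 1#   ≡⟨ ∂-* 1# 1# ⟨
    ∂ (1# * 1#)             ≡⟨ cong ∂ (*-identityʳ 1#) ⟩
    ∂ 1# ∎)
    where open ≡-Reasoning

  const-+ : ∀ {a b} → IsConst a → IsConst b → IsConst (a + b)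
  const-+ {a} {b} a′≡0 b′≡0 = trans (∂-+ a b) (trans (cong₂ _+_ a′≡0 b′≡0) (+-identityʳ 0#))

  const-* : ∀ {a b} → IsConst a → IsConst b → IsConst (a * b)
  const-* {a} {b} a′≡0 b′≡0 = begin
    ∂ (a * b)           ≡⟨ ∂-* a b ⟩
    ∂ a * b + a * ∂ b   ≡⟨ cong₂ (λ x y → x * b + a * y) a′≡0 b′≡0 ⟩
    0# * b + a * 0#     ≡⟨ cong₂ _+_ (zeroˡ b) (zeroʳ a) ⟩
    0# + 0#             ≡⟨ +-identityʳ 0# ⟩
    0# ∎
    where open ≡-Reasoning

  const-neg : ∀ {a} → IsConst a → IsConst (- a)
  const-neg {a} a′≡0 = begin
    ∂ (- a)    ≡⟨ +-inverseʳ-unique (∂ a) (∂ (- a)) ∂a+∂[-a]≡0 ⟩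
    - ∂ a      ≡⟨ cong -_ a′≡0 ⟩
    - 0#       ≡⟨ -0#≈0# ⟩
    0# ∎
    where
    open ≡-Reasoning
    ∂a+∂[-a]≡0 : ∂ a + ∂ (- a) ≡ 0#
    ∂a+∂[-a]≡0 = trans (sym (∂-+ a (- a))) (trans (cong ∂ (-‿inverseʳ a)) const-0)

  const-inverse : ∀ {c d} → IsConst c → c ≢ 0# → c * d ≡ 1# → IsConst d
  const-inverse {c} {d} c′≡0 c≢0 cd≡1 = cancel-nonzero c≢0 (begin
    c * ∂ d              ≡⟨ +-identityˡ (c * ∂ d) ⟨
    0# + c * ∂ d         ≡⟨ cong (_+ c * ∂ d) (trans (cong (_* d) c′≡0) (zeroˡ d)) ⟨
    ∂ c * d + c * ∂ d    ≡⟨ ∂-* c d ⟨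
    ∂ (c * d)            ≡⟨ cong ∂ cd≡1 ⟩
    ∂ 1#                 ≡⟨ const-1 ⟩
    0# ∎)
    where open ≡-Reasoning

  const-abs : ∀ {c} → IsConst c → IsConst (abs c)
  const-abs {c} c′≡0 with abs-cases c
  ... | inj₁ e = subst IsConst (sym e) c′≡0
  ... | inj₂ e = subst IsConst (sym e) (const-neg c′≡0)

  record PosConstInverse (c : Carrier) : Set where
    field
      inv     : Carrier
      c*inv≡1 : c * inv ≡ 1#
      inv-const : IsConst inv
      inv-pos : 0# < inv

  pos-const-inverse : ∀ {c} → IsConst c → 0# < c → PosConstInverse c
  pos-const-inverse {c} c′≡0 0<c = record
    { inv = d ; c*inv≡1 = cd≡1
    ; inv-const = const-inverse c′≡0 (pos⇒≢0 0<c) cd≡1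
    ; inv-pos = inverse-pos 0<c cd≡1 }
    where
    d : Carrier
    d = proj₁ (inverse c (pos⇒≢0 0<c))
    cd≡1 : c * d ≡ 1#
    cd≡1 = proj₂ (inverse c (pos⇒≢0 0<c))

  two : Carrier
  two = 1# + 1#

  double : ∀ x → x + x ≡ two * x
  double x = sym (trans (distribʳ x 1# 1#) (cong₂ _+_ (*-identityˡ x) (*-identityˡ x)))

  0<two : 0# < two
  0<two = 0≤two , λ 0≡2 → 0≢1 (sym (0≤both⇒≡0 0≤1 (subst (0# ≤_) (1≡-1 0≡2) 0≤1)))
    where
    0≤two : 0# ≤ two
    0≤two = subst (_≤ two) (+-identityʳ 0#) (+-mono₂-≤ 0≤1 0≤1)
    1≡-1 : 0# ≡ two → 1# ≡ - 1#
    1≡-1 0≡2 = +-inverseʳ-unique 1# 1# (sym 0≡2)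

  module Half = PosConstInverse (pos-const-inverse (const-+ const-1 const-1) 0<two)

  half : Carrier
  half = Half.inv

  half+half≡1 : half + half ≡ 1#
  half+half≡1 = trans (double half) Half.c*inv≡1

module Dominance (K : HField) where
  open HField K
  open FieldFacts K

  infix 4 _≲_ _≺_

  _≲_ : Carrier → Carrier → Set
  a ≲ b = ∃[ c ] (IsConst c × 0# < c × abs a ≤ c * abs b)

  _≺_ : Carrier → Carrier → Set
  a ≺ b = ∀ d → IsConst d → 0# < d → abs a ≤ d * abs b

  ≼⇒≲ : ∀ {a b} → a ≼ b → a ≲ b
  ≼⇒≲ (c , c′≡0 , 0<c , u , v , u=|a| , v=|b| , u≤cv) =
    c , c′≡0 , 0<c , subst₂ (λ x y → x ≤ c * y) (IsAbs⇒≡abs u=|a|) (IsAbs⇒≡abs v=|b|) u≤cv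

  ≲⇒≼ : ∀ {a b} → a ≲ b → a ≼ b
  ≲⇒≼ {a} {b} (c , c′≡0 , 0<c , |a|≤c|b|) =
    c , c′≡0 , 0<c , abs a , abs b , abs-IsAbs a , abs-IsAbs b , |a|≤c|b|

  ≤⇒≲ : ∀ {a b} → abs a ≤ abs b → a ≲ b
  ≤⇒≲ {a} {b} |a|≤|b| = 1# , const-1 , 0<1 , subst (abs a ≤_) (sym (*-identityˡ _)) |a|≤|b|

  ≺⇒≲ : ∀ {a b} → a ≺ b → a ≲ b
  ≺⇒≲ a≺b = 1# , const-1 , 0<1 , a≺b 1# const-1 0<1

  ≲-trans : ∀ {a b c} → a ≲ b → b ≲ c → a ≲ c
  ≲-trans {a} {b} {c} (k , k′≡0 , 0<k , |a|≤k|b|) (l , l′≡0 , 0<l , |b|≤l|c|) =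
    k * l , const-* k′≡0 l′≡0 , *-pos 0<k 0<l ,
    ≤-trans |a|≤k|b| (subst (k * abs b ≤_) (sym (*-assoc k l (abs c)))
                                (*-monoˡ-≤ k (proj₁ 0<k) |b|≤l|c|))

  private
    cancel-const : ∀ k k⁻¹ x → k * k⁻¹ ≡ 1# → k * (k⁻¹ * x) ≡ x
    cancel-const k k⁻¹ x kk⁻¹≡1 =
      trans (sym (*-assoc k k⁻¹ x)) (trans (cong (_* x) kk⁻¹≡1) (*-identityˡ x))

  ≲-≺-trans : ∀ {a b c} → a ≲ b → b ≺ c → a ≺ c
  ≲-≺-trans {a} {b} {c} (k , k′≡0 , 0<k , |a|≤k|b|) b≺c d d′≡0 0<d =
    ≤-trans |a|≤k|b| (subst (k * abs b ≤_) k[k⁻¹[dc]]≡dc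
      (*-monoˡ-≤ k (proj₁ 0<k) (subst (abs b ≤_) (*-assoc k⁻¹ d (abs c))
        (b≺c (k⁻¹ * d) (const-* inv-const d′≡0) (*-pos inv-pos 0<d)))))
    where
    open PosConstInverse (pos-const-inverse k′≡0 0<k) renaming (inv to k⁻¹)
    k[k⁻¹[dc]]≡dc : k * (k⁻¹ * (d * abs c)) ≡ d * abs c
    k[k⁻¹[dc]]≡dc = cancel-const k k⁻¹ (d * abs c) c*inv≡1

  ≺-≲-trans : ∀ {a b c} → a ≺ b → b ≲ c → a ≺ c
  ≺-≲-trans {a} {b} {c} a≺b (k , k′≡0 , 0<k , |b|≤k|c|) d d′≡0 0<d =
    ≤-trans (a≺b (d * k⁻¹) (const-* d′≡0 inv-const) dk⁻¹>0)
            (subst (d * k⁻¹ * abs b ≤_) dk⁻¹[kc]≡dc (*-monoˡ-≤ (d * k⁻¹) (proj₁ dk⁻¹>0) |b|≤k|c|))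
    where
    open PosConstInverse (pos-const-inverse k′≡0 0<k) renaming (inv to k⁻¹)
    dk⁻¹>0 : 0# < (d * k⁻¹)
    dk⁻¹>0 = *-pos 0<d inv-pos
    dk⁻¹[kc]≡dc : d * k⁻¹ * (k * abs c) ≡ d * abs c
    dk⁻¹[kc]≡dc = trans (regroup d k⁻¹ k (abs c)) (cancel-const k k⁻¹ (d * abs c) c*inv≡1)
      where
      regroup : ∀ d i k x → d * i * (k * x) ≡ k * (i * (d * x))
      regroup = solve 4 (λ d i k x → d :* i :* (k :* x) := k :* (i :* (d :* x))) refl

  ≺-trans : ∀ {a b c} → a ≺ b → b ≺ c → a ≺ c
  ≺-trans a≺b = ≲-≺-trans (≺⇒≲ a≺b)

  0≺ : ∀ b → 0# ≺ b
  0≺ b d _ 0<d = subst (_≤ d * abs b) (sym abs-0) (*-nonneg _ _ (proj₁ 0<d) (abs-nonneg b))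

  ≺-neg : ∀ {a b} → a ≺ b → - a ≺ - b
  ≺-neg {a} {b} a≺b d d′≡0 0<d =
    subst₂ (λ x y → x ≤ d * y) (sym (abs-neg a)) (sym (abs-neg b)) (a≺b d d′≡0 0<d)

  ≴⇒≻ : ∀ {a b} → ¬ (a ≲ b) → b ≺ a
  ≴⇒≻ {a} {b} a≴b d d′≡0 0<d with total (abs b) (d * abs a)
  ... | inj₁ |b|≤d|a| = |b|≤d|a|
  ... | inj₂ d|a|≤|b| = ⊥-elim (a≴b (d⁻¹ , inv-const , inv-pos , |a|≤d⁻¹|b|))
    where
    open PosConstInverse (pos-const-inverse d′≡0 0<d) renaming (inv to d⁻¹)
    d⁻¹[d|a|]≡|a| : d⁻¹ * (d * abs a) ≡ abs a
    d⁻¹[d|a|]≡|a| = cancel-const d⁻¹ d (abs a) (trans (*-comm d⁻¹ d) c*inv≡1)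
    |a|≤d⁻¹|b| : abs a ≤ d⁻¹ * abs b
    |a|≤d⁻¹|b| = subst (_≤ d⁻¹ * abs b) d⁻¹[d|a|]≡|a| (*-monoˡ-≤ d⁻¹ (proj₁ inv-pos) d|a|≤|b|)

  *const≲ : ∀ {b q} → IsConst q → q ≢ 0# → b * q ≲ b
  *const≲ {b} {q} q′≡0 q≢0 =
    abs q , const-abs q′≡0 , abs-pos q≢0 , ≤-reflexive (trans (abs-* b q) (*-comm _ _))

  ≲*const : ∀ {b q} → IsConst q → q ≢ 0# → b ≲ b * q
  ≲*const {b} {q} q′≡0 q≢0 = |q|⁻¹ , inv-const , inv-pos , ≤-reflexive (sym |q|⁻¹|bq|≡|b|)
    where
    open PosConstInverse (pos-const-inverse (const-abs q′≡0) (abs-pos q≢0)) renaming (inv to |q|⁻¹)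
    |q|⁻¹|bq|≡|b| : |q|⁻¹ * abs (b * q) ≡ abs b
    |q|⁻¹|bq|≡|b| = trans (cong (|q|⁻¹ *_) (trans (abs-* b q) (*-comm (abs b) (abs q))))
                          (cancel-const |q|⁻¹ (abs q) (abs b) (trans (*-comm |q|⁻¹ (abs q)) c*inv≡1))

  -- Leading terms: adding something infinitesimally smaller than a
  -- nonzero B changes neither its being nonzero, nor its sign, nor its
  -- dominance class.  The proofs use |R| ≤ ½|B|.
  module LeadingTerm {B R : Carrier} (B≢0 : B ≢ 0#) (R≺B : R ≺ B) where
    private
      |R|≤½|B| : abs R ≤ half * abs B
      |R|≤½|B| = R≺B half Half.inv-const Half.inv-pos

      halves : ∀ x → x ≡ half * x + half * x
      halves x = trans (sym (*-identityˡ x))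
                 (trans (cong (_* x) (sym half+half≡1)) (distribʳ x half half))

      0≤½|B| : 0# ≤ half * abs B
      0≤½|B| = *-nonneg half (abs B) (proj₁ Half.inv-pos) (abs-nonneg B)

      ½|B|≤|B+R| : half * abs B ≤ abs (B + R)
      ½|B|≤|B+R| = +-cancelʳ-≤ (half * abs B) (subst (_≤ abs (B + R) + half * abs B) (halves (abs B))
        (≤-trans (subst (_≤ abs (B + R) + abs (- R)) (cong abs B+R-R≡B) (triangle (B + R) (- R)))
                 (+-monoˡ-≤ (abs (B + R)) (subst (_≤ half * abs B) (sym (abs-neg R)) |R|≤½|B|))))
        where
        B+R-R≡B : (B + R) + (- R) ≡ B
        B+R-R≡B = solve 2 (λ B R → (B :+ R) :+ (:- R) := B) refl B R

    sum≢0 : B + R ≢ 0#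
    sum≢0 B+R≡0 = B≢0 (abs≡0⇒≡0 (cancel-nonzero (pos⇒≢0 Half.inv-pos) ½|B|≡0))
      where
      ½|B|≡0 : half * abs B ≡ 0#
      ½|B|≡0 = antisym (subst (half * abs B ≤_) (trans (cong abs B+R≡0) abs-0) ½|B|≤|B+R|) 0≤½|B|

    sum-nonneg : 0# ≤ B → 0# ≤ B + R
    sum-nonneg 0≤B = ≤-trans (*-nonneg half B (proj₁ Half.inv-pos) 0≤B)
                             (subst (_≤ B + R) B-½B≡½B (+-monoˡ-≤ B -½B≤R))
      where
      -½B≤R : - (half * B) ≤ R
      -½B≤R = ≤-trans (neg-antitone (subst (λ x → abs R ≤ half * x) (abs-of-nonneg 0≤B) |R|≤½|B|)) (-abs≤ R)
      B-½B≡½B : B + (- (half * B)) ≡ half * B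
      B-½B≡½B = trans (cong (_+ (- (half * B))) (halves B))
                      (solve 1 (λ x → x :+ x :+ (:- x) := x) refl (half * B))

    sum≲lead : B + R ≲ B
    sum≲lead = two , const-+ const-1 const-1 , 0<two ,
      ≤-trans (triangle B R) (subst (abs B + abs R ≤_) (double (abs B))
                               (+-monoˡ-≤ (abs B) (subst (abs R ≤_) (*-identityˡ _) (R≺B 1# const-1 0<1))))

    lead≲sum : B ≲ B + R
    lead≲sum = two , const-+ const-1 const-1 , 0<two ,
      subst (_≤ two * abs (B + R)) two[½|B|]≡|B| (*-monoˡ-≤ two (proj₁ 0<two) ½|B|≤|B+R|)
      where
      two[½|B|]≡|B| : two * (half * abs B) ≡ abs B
      two[½|B|]≡|B| = cancel-const two half (abs B) Half.c*inv≡1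

  sum-nonpos : ∀ {B R} → B ≢ 0# → R ≺ B → B ≤ 0# → B + R ≤ 0#
  sum-nonpos {B} {R} B≢0 R≺B B≤0 =
    neg-antitone⁻¹ (subst₂ _≤_ (sym -0#≈0#) (-‿+-comm B R)
      (LeadingTerm.sum-nonneg (B≢0 ∘ neg≡0⇒≡0) (≺-neg R≺B) (nonpos⇒0≤neg B≤0)))

  sum-nonneg⁻¹ : ∀ {B R} → B ≢ 0# → R ≺ B → 0# ≤ B + R → 0# ≤ B
  sum-nonneg⁻¹ {B} {R} B≢0 R≺B 0≤B+R = [ id , nonpos-impossible ]′ (total 0# B)
    where
    nonpos-impossible : B ≤ 0# → 0# ≤ B
    nonpos-impossible B≤0 = ⊥-elim (LeadingTerm.sum≢0 B≢0 R≺B (antisym (sum-nonpos B≢0 R≺B B≤0) 0≤B+R))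

  -- Axiom (H1) in relative form: if b ≲ b₁ ≠ 0 then b is a constant
  -- multiple of b₁ up to an error that is infinitesimal relative to b₁.
  H1-relative : ∀ {b b₁} → b₁ ≢ 0# → b ≲ b₁ → ∃[ c ] (IsConst c × (b - (c * b₁)) ≺ b₁)
  H1-relative {b} {b₁} b₁≢0 (k , k′≡0 , 0<k , |b|≤k|b₁|) = c , c′≡0 , error≺b₁
    where
    b₁⁻¹ : Carrier
    b₁⁻¹ = proj₁ (inverse b₁ b₁≢0)
    b₁b₁⁻¹≡1 : b₁ * b₁⁻¹ ≡ 1#
    b₁b₁⁻¹≡1 = proj₂ (inverse b₁ b₁≢0)
    u : Carrier
    u = b * b₁⁻¹
    |u|≤k : abs u ≤ k
    |u|≤k = subst₂ _≤_ (sym (abs-* b b₁⁻¹)) k|b₁||b₁⁻¹|≡k (*-monoʳ-≤ (abs b₁⁻¹) (abs-nonneg b₁⁻¹) |b|≤k|b₁|)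
      where
      k|b₁||b₁⁻¹|≡k : k * abs b₁ * abs b₁⁻¹ ≡ k
      k|b₁||b₁⁻¹|≡k = begin
        k * abs b₁ * abs b₁⁻¹     ≡⟨ *-assoc k _ _ ⟩
        k * (abs b₁ * abs b₁⁻¹)   ≡⟨ cong (k *_) (abs-* b₁ b₁⁻¹) ⟨
        k * abs (b₁ * b₁⁻¹)       ≡⟨ cong (λ x → k * abs x) b₁b₁⁻¹≡1 ⟩
        k * abs 1#                ≡⟨ cong (k *_) (abs-of-nonneg 0≤1) ⟩
        k * 1#                    ≡⟨ *-identityʳ k ⟩
        k ∎
        where open ≡-Reasoning
    H1-at-u : ∃[ c ] (IsConst c × Ino (u - c))
    H1-at-u = H1 u (k , k′≡0 , 0<k , abs u , abs-IsAbs u , |u|≤k)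
    c : Carrier
    c = proj₁ H1-at-u
    c′≡0 : IsConst c
    c′≡0 = proj₁ (proj₂ H1-at-u)
    u-c∈𝔬 : Ino (u - c)
    u-c∈𝔬 = proj₂ (proj₂ H1-at-u)
    error≡[u-c]b₁ : b - (c * b₁) ≡ (u - c) * b₁
    error≡[u-c]b₁ = begin
      b - (c * b₁)                          ≡⟨ cong (λ x → x - (c * b₁)) (*-identityʳ b) ⟨
      (b * 1#) - (c * b₁)                   ≡⟨ cong (λ x → (b * x) - (c * b₁)) (trans (*-comm b₁⁻¹ b₁) b₁b₁⁻¹≡1) ⟨
      (b * (b₁⁻¹ * b₁)) - (c * b₁)          ≡⟨ factor b b₁⁻¹ c b₁ ⟩
      (u - c) * b₁ ∎
      where
      open ≡-Reasoning
      factor : ∀ b i c b₁ → (b * (i * b₁)) - (c * b₁) ≡ ((b * i) - c) * b₁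
      factor = solve 4 (λ b i c b₁ → b :* (i :* b₁) :+ (:- (c :* b₁)) := (b :* i :+ (:- c)) :* b₁) refl
    error≺b₁ : (b - (c * b₁)) ≺ b₁
    error≺b₁ d d′≡0 0<d =
      subst (_≤ d * abs b₁) (sym (trans (cong abs error≡[u-c]b₁) (abs-* (u - c) b₁)))
            (*-monoʳ-≤ (abs b₁) (abs-nonneg b₁) |u-c|≤d)
      where
      |u-c|<d : AbsLt (u - c) d
      |u-c|<d = u-c∈𝔬 d d′≡0 0<d
      |u-c|≤d : abs (u - c) ≤ d
      |u-c|≤d = subst (_≤ d) (IsAbs⇒≡abs (proj₁ (proj₂ |u-c|<d))) (proj₁ (proj₂ (proj₂ |u-c|<d)))

-- At a point x of Cⁿ every term t(x) of K is a sum Σⱼ bⱼ·Qⱼ(x) with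
-- coefficients bⱼ ∈ K independent of x and polynomials Qⱼ over C:
-- the derivation only acts on the coefficients, because Qⱼ(x) ∈ C.
module Expansion (K : HField) where
  open HField K
  open FieldFacts K

  -- a summand b·Q with b ∈ K and Q a polynomial with constant coefficients
  Summand : ℕ → Set
  Summand n = Carrier × CTerm K n

  Expansion : ℕ → Set
  Expansion n = List (Summand n)

  point : ∀ {n} → (Fin n → Const K) → Fin n → Carrier
  point x i = proj₁ (x i)

  module _ {n : ℕ} (x : Fin n → Const K) where
    poly : CTerm K n → Carrier
    poly = evalCT K x

    value : Expansion n → Carrier
    value []            = 0#
    value ((b , Q) ∷ L) = b * poly Q + value L

    poly-const : ∀ Q → IsConst (poly Q)
    poly-const (var i)  = proj₂ (x i)
    poly-const (par c)  = proj₂ c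
    poly-const `0       = const-0
    poly-const `1       = const-1
    poly-const (s `+ t) = const-+ (poly-const s) (poly-const t)
    poly-const (s `* t) = const-* (poly-const s) (poly-const t)
    poly-const (`- t)   = const-neg (poly-const t)

  _⊕_ : ∀ {n} → Expansion n → Expansion n → Expansion n
  _⊕_ = _++_

  scale : ∀ {n} → Summand n → Expansion n → Expansion n
  scale s              []              = []
  scale s@(b , Q)      ((b₁ , Q₁) ∷ M) = (b * b₁ , Q `* Q₁) ∷ scale s M

  _⊗_ : ∀ {n} → Expansion n → Expansion n → Expansion n
  []      ⊗ M = []
  (s ∷ L) ⊗ M = scale s M ⊕ (L ⊗ M)

  ⊖_ : ∀ {n} → Expansion n → Expansion n
  ⊖ []            = []
  ⊖ ((b , Q) ∷ L) = (b , `- Q) ∷ ⊖ L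

  δ : ∀ {n} → Expansion n → Expansion n
  δ []            = []
  δ ((b , Q) ∷ L) = (∂ b , Q) ∷ δ L

  expand : ∀ {n} → Term K n → Expansion n
  expand (var i)  = (1# , var i) ∷ []
  expand (par a)  = (a , `1) ∷ []
  expand `0       = []
  expand `1       = (1# , `1) ∷ []
  expand (s `+ t) = expand s ⊕ expand t
  expand (s `* t) = expand s ⊗ expand t
  expand (`- t)   = ⊖ expand t
  expand (`∂ t)   = δ (expand t)

  module _ {n : ℕ} (x : Fin n → Const K) where
    open ≡-Reasoning

    value-⊕ : ∀ L M → value x (L ⊕ M) ≡ value x L + value x M
    value-⊕ []            M = sym (+-identityˡ _)
    value-⊕ ((b , Q) ∷ L) M = begin
      b * poly x Q + value x (L ⊕ M)          ≡⟨ cong ((b * poly x Q) +_) (value-⊕ L M) ⟩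
      b * poly x Q + (value x L + value x M)  ≡⟨ +-assoc _ _ _ ⟨
      b * poly x Q + value x L + value x M ∎

    value-scale : ∀ b Q M → value x (scale (b , Q) M) ≡ b * poly x Q * value x M
    value-scale b Q []              = sym (zeroʳ _)
    value-scale b Q ((b₁ , Q₁) ∷ M) = begin
      b * b₁ * (poly x Q * poly x Q₁) + value x (scale (b , Q) M)
        ≡⟨ cong ((b * b₁ * (poly x Q * poly x Q₁)) +_) (value-scale b Q M) ⟩
      b * b₁ * (poly x Q * poly x Q₁) + b * poly x Q * value x M
        ≡⟨ solve 5 (λ b b₁ q q₁ v → b :* b₁ :* (q :* q₁) :+ b :* q :* v
                                   := b :* q :* (b₁ :* q₁ :+ v)) refl b b₁ (poly x Q) (poly x Q₁) (value x M) ⟩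
      b * poly x Q * (b₁ * poly x Q₁ + value x M) ∎

    value-⊗ : ∀ L M → value x (L ⊗ M) ≡ value x L * value x M
    value-⊗ []            M = sym (zeroˡ _)
    value-⊗ ((b , Q) ∷ L) M = begin
      value x (scale (b , Q) M ⊕ (L ⊗ M))                  ≡⟨ value-⊕ (scale (b , Q) M) (L ⊗ M) ⟩
      value x (scale (b , Q) M) + value x (L ⊗ M)          ≡⟨ cong₂ _+_ (value-scale b Q M) (value-⊗ L M) ⟩
      b * poly x Q * value x M + value x L * value x M     ≡⟨ distribʳ _ _ _ ⟨
      (b * poly x Q + value x L) * value x M ∎

    value-⊖ : ∀ L → value x (⊖ L) ≡ - value x L
    value-⊖ []            = sym -0#≈0#
    value-⊖ ((b , Q) ∷ L) = begin
      b * (- poly x Q) + value x (⊖ L)     ≡⟨ cong ((b * (- poly x Q)) +_) (value-⊖ L) ⟩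
      b * (- poly x Q) + (- value x L)     ≡⟨ cong (_+ (- value x L)) (-‿distribʳ-* b (poly x Q)) ⟨
      (- (b * poly x Q)) + (- value x L)   ≡⟨ -‿+-comm _ _ ⟩
      - (b * poly x Q + value x L) ∎

    -- the derivative of b·Q(x) is b′·Q(x) since Q(x) is a constant
    value-δ : ∀ L → value x (δ L) ≡ ∂ (value x L)
    value-δ []            = sym const-0
    value-δ ((b , Q) ∷ L) = sym (begin
      ∂ (b * poly x Q + value x L)                  ≡⟨ ∂-+ _ _ ⟩
      ∂ (b * poly x Q) + ∂ (value x L)              ≡⟨ cong (_+ ∂ (value x L)) (∂-* b (poly x Q)) ⟩
      ∂ b * poly x Q + b * ∂ (poly x Q) + ∂ (value x L)
        ≡⟨ cong (λ z → ∂ b * poly x Q + b * z + ∂ (value x L)) (poly-const x Q) ⟩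
      ∂ b * poly x Q + b * 0# + ∂ (value x L)       ≡⟨ cong (λ z → ∂ b * poly x Q + z + ∂ (value x L)) (zeroʳ b) ⟩
      ∂ b * poly x Q + 0# + ∂ (value x L)           ≡⟨ cong (_+ ∂ (value x L)) (+-identityʳ _) ⟩
      ∂ b * poly x Q + ∂ (value x L)                ≡⟨ cong ((∂ b * poly x Q) +_) (value-δ L) ⟨
      ∂ b * poly x Q + value x (δ L) ∎)

    expand-correct : ∀ t → evalT K (point x) t ≡ value x (expand t)
    expand-correct (var i)  = sym (trans (+-identityʳ _) (*-identityˡ _))
    expand-correct (par a)  = sym (trans (+-identityʳ _) (*-identityʳ _))
    expand-correct `0       = refl
    expand-correct `1       = sym (trans (+-identityʳ _) (*-identityʳ _))
    expand-correct (s `+ t) = trans (cong₂ _+_ (expand-correct s) (expand-correct t)) (sym (value-⊕ (expand s) (expand t)))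
    expand-correct (s `* t) = trans (cong₂ _*_ (expand-correct s) (expand-correct t)) (sym (value-⊗ (expand s) (expand t)))
    expand-correct (`- t)   = trans (cong -_ (expand-correct t)) (sym (value-⊖ (expand t)))
    expand-correct (`∂ t)   = trans (cong ∂ (expand-correct t)) (sym (value-δ (expand t)))

-- Using (H1), every expansion can be
-- brought into normal form without changing its value at any point of Cⁿ.
module Normalisation (em : ExcludedMiddle 0ℓ) (K : HField) where
  open HField K
  open FieldFacts K
  open Dominance K
  open Expansion K

  AllBelow : ∀ {n} → Carrier → Expansion n → Set
  AllBelow z L = All (λ s → proj₁ s ≺ z) L

  Normal : ∀ {n} → Expansion n → Set
  Normal []            = ⊤
  Normal ((b , Q) ∷ L) = (b ≢ 0#) × AllBelow b L × Normal L

  record Insertion {n} (L : Expansion n) (b : Carrier) (Q : CTerm K n) : Set where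
    field
      result     : Expansion n
      normal     : Normal result
      same-value : ∀ x → value x result ≡ b * poly x Q + value x L
      bounded    : ∀ z → b ≺ z → AllBelow z L → AllBelow z result

  insert : ∀ {n} (L : Expansion n) → Normal L → ∀ b Q → Insertion L b Q
  insert L normal-L b Q with em {b ≡ 0#}
  ... | yes b≡0 = record
    { result = L ; normal = normal-L ; bounded = λ _ _ below → below
    ; same-value = λ x → sym (trans (cong (λ y → y * poly x Q + value x L) b≡0)
                             (trans (cong (_+ value x L) (zeroˡ _)) (+-identityˡ _))) }
  insert [] _ b Q | no b≢0 = record
    { result = (b , Q) ∷ [] ; normal = b≢0 , [] , tt
    ; same-value = λ x → refl ; bounded = λ _ b≺z _ → b≺z ∷ [] }
  insert ((b₁ , Q₁) ∷ L) normal-L@(b₁≢0 , L≺b₁ , normal-tail) b Q | no b≢0 with em {b ≲ b₁}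
  ... | no b≴b₁ = record
    { result = (b , Q) ∷ (b₁ , Q₁) ∷ L
    ; normal = b≢0 , (b₁≺b ∷ All.map (λ s≺b₁ → ≺-trans s≺b₁ b₁≺b) L≺b₁) , normal-L
    ; same-value = λ x → refl ; bounded = λ _ b≺z below → b≺z ∷ below }
    where
    b₁≺b : b₁ ≺ b
    b₁≺b = ≴⇒≻ b≴b₁
  -- b = c·b₁ + (b - c·b₁): move c·Q into the leading summand, insert the rest
  ... | yes b≲b₁ = record
    { result = (b₁ , Q₁ `+ (par (c , c′≡0) `* Q)) ∷ rest.result
    ; normal = b₁≢0 , rest.bounded b₁ error≺b₁ L≺b₁ , rest.normal
    ; same-value = λ x → trans (cong ((b₁ * (poly x Q₁ + c * poly x Q)) +_) (rest.same-value x))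
                               (regroup b b₁ c (poly x Q) (poly x Q₁) (value x L))
    ; bounded = λ { z _ (b₁≺z ∷ below) → b₁≺z ∷ rest.bounded z (≺-trans error≺b₁ b₁≺z) below } }
    where
    approximation : ∃[ c ] (IsConst c × (b - (c * b₁)) ≺ b₁)
    approximation = H1-relative b₁≢0 b≲b₁
    c : Carrier
    c = proj₁ approximation
    c′≡0 : IsConst c
    c′≡0 = proj₁ (proj₂ approximation)
    error≺b₁ : (b - (c * b₁)) ≺ b₁
    error≺b₁ = proj₂ (proj₂ approximation)
    module rest = Insertion (insert L normal-tail (b - (c * b₁)) Q)
    regroup : ∀ b b₁ c q q₁ v →
      b₁ * (q₁ + c * q) + ((b - (c * b₁)) * q + v) ≡ b * q + (b₁ * q₁ + v)
    regroup = solve 6 (λ b b₁ c q q₁ v → b₁ :* (q₁ :+ c :* q) :+ ((b :+ (:- (c :* b₁))) :* q :+ v)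
                                         := b :* q :+ (b₁ :* q₁ :+ v)) refl

  record NormalForm {n} (L : Expansion n) : Set where
    field
      nf         : Expansion n
      normal     : Normal nf
      same-value : ∀ x → value x nf ≡ value x L

  normalise : ∀ {n} (L : Expansion n) → NormalForm L
  normalise []            = record { nf = [] ; normal = tt ; same-value = λ _ → refl }
  normalise ((b , Q) ∷ L) = record
    { nf = ins.result ; normal = ins.normal
    ; same-value = λ x → trans (ins.same-value x) (cong ((b * poly x Q) +_) (tail.same-value x)) }
    where
    module tail = NormalForm (normalise L)
    module ins = Insertion (insert tail.nf tail.normal b Q)

-- The value of a normal expansion at a point x ∈ Cⁿ is governed by its
-- first summand bⱼ·Qⱼ with Qⱼ(x) ≠ 0: the later summands are
-- infinitesimal with respect to it.  Hence whether the value is zero,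
-- nonnegative, or dominated by another such value is expressed by a
-- semialgebraic condition on x.
module Semantics (em : ExcludedMiddle 0ℓ) (K : HField) where
  open HField K
  open FieldFacts K
  open Dominance K
  open Expansion K
  open Normalisation em K
  open Equivalence using (to; from)

  module AtPoint {n : ℕ} (x : Fin n → Const K) where

    vanishing-head : ∀ b Q L → poly x Q ≡ 0# → value x ((b , Q) ∷ L) ≡ value x L
    vanishing-head b Q L Q≡0 =
      trans (cong (λ q → b * q + value x L) Q≡0) (trans (cong (_+ value x L) (zeroʳ b)) (+-identityˡ _))

    ≺coefficient⇒≺summand : ∀ {v b} Q → v ≺ b → poly x Q ≢ 0# → v ≺ b * poly x Q
    ≺coefficient⇒≺summand Q v≺b Q≢0 = ≺-≲-trans v≺b (≲*const (poly-const x Q) Q≢0)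

    value-≺ : ∀ (L : Expansion n) → Normal L → ∀ z → AllBelow z L → value x L ≺ z
    value-≺ []            _                         z _ = 0≺ z
    value-≺ ((b , Q) ∷ L) (b≢0 , L≺b , normal-L) z (b≺z ∷ L≺z) with em {poly x Q ≡ 0#}
    ... | yes Q≡0 = subst (_≺ z) (sym (vanishing-head b Q L Q≡0)) (value-≺ L normal-L z L≺z)
    ... | no Q≢0 = ≲-≺-trans (≲-trans (LeadingTerm.sum≲lead (*-≢0 b≢0 Q≢0) tail≺head)
                                       (*const≲ (poly-const x Q) Q≢0)) b≺z
      where
      tail≺head : value x L ≺ b * poly x Q
      tail≺head = ≺coefficient⇒≺summand Q (value-≺ L normal-L b L≺b) Q≢0

    module Head b Q L (normal : Normal ((b , Q) ∷ L)) (Q≢0 : poly x Q ≢ 0#) where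
      head≢0 : b * poly x Q ≢ 0#
      head≢0 = *-≢0 (proj₁ normal) Q≢0

      tail≺head : value x L ≺ b * poly x Q
      tail≺head = ≺coefficient⇒≺summand Q (value-≺ L (proj₂ (proj₂ normal)) b (proj₁ (proj₂ normal))) Q≢0

      open LeadingTerm head≢0 tail≺head public

      value≲coefficient : value x ((b , Q) ∷ L) ≲ b
      value≲coefficient = ≲-trans sum≲lead (*const≲ (poly-const x Q) Q≢0)

      coefficient≲value : b ≲ value x ((b , Q) ∷ L)
      coefficient≲value = ≲-trans (≲*const (poly-const x Q) Q≢0) lead≲sum

  truth : ∀ {n} → Set → CQF K n
  truth P with em {P}
  ... | yes _ = `⊤
  ... | no _  = `⊥

  ifZero_then_else_ : ∀ {n} → CTerm K n → CQF K n → CQF K n → CQF K n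
  ifZero Q then φ else ψ = ((Q `≡ `0) `∧ φ) `∨ ((`¬ (Q `≡ `0)) `∧ ψ)

  sameSign : ∀ {n} → Carrier → CTerm K n → CQF K n
  sameSign b Q with total 0# b
  ... | inj₁ _ = `0 `≤ Q
  ... | inj₂ _ = Q `≤ `0

  vanishes : ∀ {n} → Expansion n → CQF K n
  vanishes []            = `⊤
  vanishes ((b , Q) ∷ L) = ifZero Q then vanishes L else `⊥

  nonnegative : ∀ {n} → Expansion n → CQF K n
  nonnegative []            = `⊤
  nonnegative ((b , Q) ∷ L) = ifZero Q then nonnegative L else sameSign b Q

  dominates : ∀ {n} → Carrier → Expansion n → CQF K n
  dominates b []              = `⊥
  dominates b ((b₁ , Q₁) ∷ M) = ifZero Q₁ then dominates b M else truth (b ≲ b₁)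

  dominated : ∀ {n} → Expansion n → Expansion n → CQF K n
  dominated []            M = `⊤
  dominated ((b , Q) ∷ L) M = ifZero Q then dominated L M else dominates b M

  module _ {n : ℕ} (x : Fin n → Const K) where
    open AtPoint x

    truth-sem : ∀ P → SatC K x (truth {n} P) ⇔ P
    truth-sem P with em {P}
    ... | yes p  = mk⇔ (λ _ → p) (λ _ → tt)
    ... | no ¬p = mk⇔ ⊥-elim ¬p

    ifZero-sem : ∀ (P : Carrier → Set) b Q L φ ψ →
      (SatC K x φ ⇔ P (value x L)) →
      (poly x Q ≢ 0# → SatC K x ψ ⇔ P (value x ((b , Q) ∷ L))) →
      SatC K x (ifZero Q then φ else ψ) ⇔ P (value x ((b , Q) ∷ L))
    ifZero-sem P b Q L φ ψ φ-sem ψ-sem = mk⇔ to′ from′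
      where
      to′ : SatC K x (ifZero Q then φ else ψ) → P (value x ((b , Q) ∷ L))
      to′ (inj₁ (Q≡0 , φ-holds)) = subst P (sym (vanishing-head b Q L Q≡0)) (to φ-sem φ-holds)
      to′ (inj₂ (Q≢0 , ψ-holds)) = to (ψ-sem Q≢0) ψ-holds
      from′ : P (value x ((b , Q) ∷ L)) → SatC K x (ifZero Q then φ else ψ)
      from′ p with em {poly x Q ≡ 0#}
      ... | yes Q≡0 = inj₁ (Q≡0 , from φ-sem (subst P (vanishing-head b Q L Q≡0) p))
      ... | no Q≢0  = inj₂ (Q≢0 , from (ψ-sem Q≢0) p)

    sameSign-sem : ∀ b Q → b ≢ 0# → SatC K x (sameSign b Q) ⇔ 0# ≤ b * poly x Q
    sameSign-sem b Q b≢0 with total 0# b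
    ... | inj₁ 0≤b = mk⇔ (*-nonneg b (poly x Q) 0≤b) (nonneg-*⁻¹ 0≤b b≢0)
    ... | inj₂ b≤0 = mk⇔ (nonpos*nonpos b≤0) (nonpos-*⁻¹ b≤0 b≢0)

    vanishes-sem : ∀ L → Normal L → SatC K x (vanishes L) ⇔ value x L ≡ 0#
    vanishes-sem []            _                 = mk⇔ (λ _ → refl) (λ _ → tt)
    vanishes-sem ((b , Q) ∷ L) normal@(_ , _ , normal-L) =
      ifZero-sem (_≡ 0#) b Q L (vanishes L) `⊥ (vanishes-sem L normal-L)
        (λ Q≢0 → mk⇔ ⊥-elim (Head.sum≢0 b Q L normal Q≢0))

    nonnegative-sem : ∀ L → Normal L → SatC K x (nonnegative L) ⇔ 0# ≤ value x L
    nonnegative-sem []            _                   = mk⇔ (λ _ → ≤-refl) (λ _ → tt)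
    nonnegative-sem ((b , Q) ∷ L) normal@(b≢0 , _ , normal-L) =
      ifZero-sem (0# ≤_) b Q L (nonnegative L) (sameSign b Q) (nonnegative-sem L normal-L) λ Q≢0 →
        mk⇔ (Head.sum-nonneg b Q L normal Q≢0 ∘ to (sameSign-sem b Q b≢0))
            (from (sameSign-sem b Q b≢0) ∘
             sum-nonneg⁻¹ (Head.head≢0 b Q L normal Q≢0) (Head.tail≺head b Q L normal Q≢0))

    dominates-sem : ∀ b M → b ≢ 0# → Normal M → SatC K x (dominates b M) ⇔ b ≲ value x M
    dominates-sem b []                b≢0 _ = mk⇔ ⊥-elim b≴0
      where
      b≴0 : b ≲ 0# → ⊥
      b≴0 (c , _ , _ , |b|≤c|0|) =
        b≢0 (abs≡0⇒≡0 (antisym (subst (abs b ≤_) (trans (cong (c *_) abs-0) (zeroʳ c)) |b|≤c|0|) (abs-nonneg b)))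
    dominates-sem b ((b₁ , Q₁) ∷ M) b≢0 normal@(_ , _ , normal-M) =
      ifZero-sem (b ≲_) b₁ Q₁ M (dominates b M) (truth (b ≲ b₁)) (dominates-sem b M b≢0 normal-M) λ Q₁≢0 →
        mk⇔ (λ b≲b₁ → ≲-trans (to (truth-sem (b ≲ b₁)) b≲b₁) (Head.coefficient≲value b₁ Q₁ M normal Q₁≢0))
            (λ b≲v → from (truth-sem (b ≲ b₁)) (≲-trans b≲v (Head.value≲coefficient b₁ Q₁ M normal Q₁≢0)))

    dominated-sem : ∀ L M → Normal L → Normal M → SatC K x (dominated L M) ⇔ value x L ≲ value x M
    dominated-sem []            M _ _ = mk⇔ (λ _ → ≤⇒≲ (subst (_≤ abs (value x M)) (sym abs-0) (abs-nonneg _))) (λ _ → tt)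
    dominated-sem ((b , Q) ∷ L) M normal@(b≢0 , _ , normal-L) normal-M =
      ifZero-sem (_≲ value x M) b Q L (dominated L M) (dominates b M) (dominated-sem L M normal-L normal-M) λ Q≢0 →
        mk⇔ (λ b≲M → ≲-trans (Head.value≲coefficient b Q L normal Q≢0) (to (dominates-sem b M b≢0 normal-M) b≲M))
            (λ v≲M → from (dominates-sem b M b≢0 normal-M) (≲-trans (Head.coefficient≲value b Q L normal Q≢0) v≲M))

module Translation (em : ExcludedMiddle 0ℓ) (K : HField) where
  open HField K
  open FieldFacts K
  open Dominance K
  open Expansion K
  open Normalisation em K
  open Semantics em K
  open Equivalence using (to; from)

  nf-term : ∀ {n} → Term K n → Expansion n
  nf-term t = NormalForm.nf (normalise (expand t))

  nf-term-normal : ∀ {n} (t : Term K n) → Normal (nf-term t)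
  nf-term-normal t = NormalForm.normal (normalise (expand t))

  nf-term-value : ∀ {n} (x : Fin n → Const K) t → evalT K (point x) t ≡ value x (nf-term t)
  nf-term-value x t = trans (expand-correct x t) (sym (NormalForm.same-value (normalise (expand t)) x))

  translate : ∀ {n} → QF K n → CQF K n
  translate (s `≡ t) = vanishes (nf-term (s `+ (`- t)))
  translate (s `≤ t) = nonnegative (nf-term (t `+ (`- s)))
  translate (s `≼ t) = dominated (nf-term s) (nf-term t)
  translate `⊤       = `⊤
  translate `⊥       = `⊥
  translate (`¬ φ)   = `¬ translate φ
  translate (φ `∧ ψ) = translate φ `∧ translate ψ
  translate (φ `∨ ψ) = translate φ `∨ translate ψ

  ≡⇔difference≡0 : ∀ {a b} → a ≡ b ⇔ (a - b) ≡ 0#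
  ≡⇔difference≡0 {a} {b} = mk⇔ (λ a≡b → trans (cong (_- b) a≡b) (-‿inverseʳ b)) (x∙y⁻¹≈ε⇒x≈y a b)

  ≤⇔difference≥0 : ∀ {a b} → a ≤ b ⇔ 0# ≤ (b - a)
  ≤⇔difference≥0 = mk⇔ ≤⇒0≤- 0≤-⇒≤

  module _ {n : ℕ} (x : Fin n → Const K) where
    private
      ⟦_⟧ : Term K n → Carrier
      ⟦ t ⟧ = evalT K (point x) t

    via-normal-form : ∀ (P : Carrier → Set) t → P ⟦ t ⟧ ⇔ P (value x (nf-term t))
    via-normal-form P t = mk⇔ (subst P (nf-term-value x t)) (subst P (sym (nf-term-value x t)))

    translate-correct : (φ : QF K n) → Sat K (point x) φ ⇔ SatC K x (translate φ)
    translate-correct (s `≡ t) = ⇔.trans ≡⇔difference≡0 (⇔.trans (via-normal-form (_≡ 0#) u)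
                                   (⇔.sym (vanishes-sem x (nf-term u) (nf-term-normal u))))
      where
      u : Term K n
      u = s `+ (`- t)
    translate-correct (s `≤ t) = ⇔.trans ≤⇔difference≥0 (⇔.trans (via-normal-form (0# ≤_) u)
                                   (⇔.sym (nonnegative-sem x (nf-term u) (nf-term-normal u))))
      where
      u : Term K n
      u = t `+ (`- s)
    translate-correct (s `≼ t) = ⇔.trans (mk⇔ ≼⇒≲ ≲⇒≼) (⇔.trans (⇔.trans
                                   (via-normal-form (_≲ ⟦ t ⟧) s) (via-normal-form (value x (nf-term s) ≲_) t))
                                   (⇔.sym (dominated-sem x (nf-term s) (nf-term t) (nf-term-normal s) (nf-term-normal t))))
    translate-correct `⊤       = ⇔.refl
    translate-correct `⊥       = ⇔.refl
    translate-correct (`¬ φ)   = ¬-cong-⇔ (translate-correct φ)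
    translate-correct (φ `∧ ψ) = translate-correct φ ×-⇔ translate-correct ψ
    translate-correct (φ `∨ ψ) = translate-correct φ ⊎-⇔ translate-correct ψ

proposition5p1 : ExcludedMiddle 0ℓ → (K : HField) → RealClosed K →
    (n : ℕ) (X : (Fin n → HField.Carrier K) → Set) →
    QFDefinable K n X → Semialgebraic K n (trace K X)
proposition5p1 em K _ n X (φ , X↔φ) = translate φ , λ x →
    to (translate-correct x φ) ∘ proj₁ (X↔φ (point x)) ,
    proj₂ (X↔φ (point x)) ∘ from (translate-correct x φ)
  where
  open Expansion K using (point)
  open Translation em K using (translate; translate-correct)
  open Equivalence using (to; from)
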